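{- Let $d,c$ be positive integers, let $V$ be a $d$-element set and let $\mathcal{H}\subseteq 2^V$ be hereditary. (1) If $|\mathcal{H}|\leq 2^d-c-1$, then there are at least $d-c$ vertices $v\in V$ with $\deg_{\mathcal{H}}(v)\leq 2^{d-1}-c-1$. (2) If $d\geq c+1$ and $\deg_{\mathcal{H}}(v)\geq 2^{d-1}-c$ for every $v\in V$, then $|\mathcal{H}|\geq 2^d-c$.
   Context: A family $\mathcal{H}$ of sets is hereditary if $F'\subseteq F\in\mathcal{H}$ implies $F'\in\mathcal{H}$. For $v\in V$, $\deg_{\mathcal{H}}(v)$ is the number of members of $\mathcal{H}$ containing $v$. -}

module Defs where

open import Data.Nat using (ℕ; zero; suc; _+_; _≤_; _≤?_)
open import Data.Bool using (Bool; true; false; if_then_else_; _∧_)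
open import Data.Fin using (Fin)
open import Data.Fin.Subset using (Subset; _⊆_; inside; outside)
open import Data.Vec using (_∷_; []; lookup)
open import Data.List using (List; _∷_; []; _++_; map; length; filter; allFin)
open import Data.Nat.ListAction using (sum)
open import Relation.Binary.PropositionalEquality using (_≡_)

allSubsets : (n : ℕ) → List (Subset n)
allSubsets zero = [] ∷ []
allSubsets (suc n) = map (inside ∷_) (allSubsets n) ++ map (outside ∷_) (allSubsets n)

-- A family of subsets of V = Fin d, given by its characteristic function on 2^V.
Family : ℕ → Set
Family d = Subset d → Bool

Hereditary : {d : ℕ} → Family d → Set
Hereditary {d} H = (F F' : Subset d) → F' ⊆ F → H F ≡ true → H F' ≡ true

card : {d : ℕ} → Family d → ℕ
card {d} H = sum (map (λ F → if H F then 1 else 0) (allSubsets d))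

deg : {d : ℕ} → Family d → Fin d → ℕ
deg {d} H v = sum (map (λ F → if H F ∧ lookup F v then 1 else 0) (allSubsets d))

-- number of vertices v with deg_H(v) + k ≤ m  (i.e. deg_H(v) ≤ m - k)
numLowDeg : {d : ℕ} → Family d → ℕ → ℕ → ℕ
numLowDeg {d} H k m = length (filter (λ v → deg H v + k ≤? m) (allFin d))

module Submission where

-- Write P = 2^(d-1), let V∖u be the co-singleton missing u, and call v
-- "high" if deg(v) ≥ P - c.  The whole argument is part (1); part (2) is its
-- contrapositive: under the degree hypothesis there is no low vertex, while
-- (1) applied to |H| ≤ 2^d - c - 1 would produce d - c ≥ 1 of them.
--
-- Since |H| < 2^d, the full set V is not in H.  If V∖u ∈ H then,
-- H being hereditary, H contains every set avoiding u, so |H| = deg(u) + P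
-- and u is low; hence every high u has V∖u ∉ H.  Now fix a high vertex v.
-- The non-members of H containing v number P - deg(v) ≤ c, and they include
-- V and every missing co-singleton V∖u with u ≠ v.  So there are at most c
-- missing co-singletons, hence at most c high vertices and at least d - c
-- low ones.

open import Defs
open import Data.Nat using (ℕ; zero; suc; _+_; _∸_; _^_; _≤_; _<_; z≤n; s≤s; _≤?_)
open import Data.Nat.Properties
open import Data.Nat.ListAction using (sum)
open import Data.Nat.ListAction.Properties using (sum-++)
open import Data.Nat.Tactic.RingSolver using (solve-∀)
open import Data.Bool using (Bool; true; false; if_then_else_; _∧_; not)
open import Data.Bool.Properties using (∧-zeroʳ)
open import Data.Fin using (Fin; zero; suc)
open import Data.Fin.Subset using (Subset; _⊆_; inside; outside)
open import Data.Vec using ([]; _∷_; lookup)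
open import Data.Vec.Properties using ([]=⇒lookup; lookup⇒[]=)
open import Data.List using (List; []; _∷_; _++_; map; length; filter; allFin)
open import Data.List.Properties using (map-++; map-∘; map-tabulate; length-tabulate; filter-none)
import Data.List.Relation.Unary.All as All
open import Data.Product using (_×_; _,_; ∃)
open import Data.Empty using (⊥-elim)
open import Function using (id; _∘_)
open import Relation.Binary.PropositionalEquality
open import Relation.Nullary using (¬_; yes; no; does; ¬?)
open import Relation.Nullary.Decidable using (dec-true)
open import Relation.Unary using (Pred; Decidable)

ι : Bool → ℕ
ι b = if b then 1 else 0

ι≤1 : ∀ b → ι b ≤ 1
ι≤1 true  = s≤s z≤n
ι≤1 false = z≤n

ι-not : ∀ b → ι b + ι (not b) ≡ 1
ι-not true  = refl
ι-not false = refl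

ι-split : ∀ a b → ι (a ∧ b) + ι (a ∧ not b) ≡ ι a
ι-split true  true  = refl
ι-split true  false = refl
ι-split false b     = refl

ι-split′ : ∀ a b → ι (a ∧ b) + ι (not a ∧ b) ≡ ι b
ι-split′ true  b = +-identityʳ (ι b)
ι-split′ false b = refl

module _ {A : Set} where

  sumOver : List A → (A → ℕ) → ℕ
  sumOver xs f = sum (map f xs)

  sumOver-cong : ∀ xs {f g : A → ℕ} → (∀ x → f x ≡ g x) → sumOver xs f ≡ sumOver xs g
  sumOver-cong []       f≡g = refl
  sumOver-cong (x ∷ xs) f≡g = cong₂ _+_ (f≡g x) (sumOver-cong xs f≡g)

  sumOver-mono : ∀ xs {f g : A → ℕ} → (∀ x → f x ≤ g x) → sumOver xs f ≤ sumOver xs g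
  sumOver-mono []       f≤g = z≤n
  sumOver-mono (x ∷ xs) f≤g = +-mono-≤ (f≤g x) (sumOver-mono xs f≤g)

  sumOver-+ : ∀ xs (f g : A → ℕ) →
    sumOver xs (λ x → f x + g x) ≡ sumOver xs f + sumOver xs g
  sumOver-+ []       f g = refl
  sumOver-+ (x ∷ xs) f g =
    trans (cong (f x + g x +_) (sumOver-+ xs f g)) (interchange (f x) (g x) _ _)
    where
    interchange : ∀ a b s t → a + b + (s + t) ≡ a + s + (b + t)
    interchange = solve-∀

  sumOver-0 : ∀ xs → sumOver xs (λ _ → 0) ≡ 0
  sumOver-0 []       = refl
  sumOver-0 (x ∷ xs) = sumOver-0 xs

  sumOver-1 : ∀ xs → sumOver xs (λ _ → 1) ≡ length xs
  sumOver-1 []       = refl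
  sumOver-1 (x ∷ xs) = cong suc (sumOver-1 xs)

  length-filter≡count : ∀ {ℓ} {P : Pred A ℓ} (P? : Decidable P) xs →
    length (filter P? xs) ≡ sumOver xs (λ x → ι (does (P? x)))
  length-filter≡count P? []       = refl
  length-filter≡count P? (x ∷ xs) with does (P? x)
  ... | true  = cong suc (length-filter≡count P? xs)
  ... | false = length-filter≡count P? xs

  count-witness : ∀ {ℓ} {P : Pred A ℓ} (P? : Decidable P) xs →
    1 ≤ sumOver xs (λ x → ι (does (P? x))) → ∃ P
  count-witness P? (x ∷ xs) pos with P? x
  ... | yes p = x , p
  ... | no _  = count-witness P? xs pos

Σ⊆ : (d : ℕ) → (Subset d → ℕ) → ℕ
Σ⊆ d = sumOver (allSubsets d)

Σ⊆-suc : ∀ n (f : Subset (suc n) → ℕ) →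
  Σ⊆ (suc n) f ≡ Σ⊆ n (λ F → f (inside ∷ F)) + Σ⊆ n (λ F → f (outside ∷ F))
Σ⊆-suc n f = begin
  sum (map f (map (inside ∷_) S ++ map (outside ∷_) S))
    ≡⟨ cong sum (map-++ f (map (inside ∷_) S) (map (outside ∷_) S)) ⟩
  sum (map f (map (inside ∷_) S) ++ map f (map (outside ∷_) S))
    ≡⟨ sum-++ (map f (map (inside ∷_) S)) (map f (map (outside ∷_) S)) ⟩
  sum (map f (map (inside ∷_) S)) + sum (map f (map (outside ∷_) S))
    ≡⟨ cong₂ _+_ (cong sum (sym (map-∘ S))) (cong sum (sym (map-∘ S))) ⟩
  Σ⊆ n (λ F → f (inside ∷ F)) + Σ⊆ n (λ F → f (outside ∷ F)) ∎
  where
  open ≡-Reasoning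
  S = allSubsets n

Σ⊆-count : ∀ d → Σ⊆ d (λ _ → 1) ≡ 2 ^ d
Σ⊆-count zero    = refl
Σ⊆-count (suc n) =
  trans (Σ⊆-suc n _) (cong₂ _+_ (Σ⊆-count n) (trans (Σ⊆-count n) (sym (+-identityʳ _))))

Σ⊆-contain : ∀ {d} (v : Fin d) → Σ⊆ d (λ F → ι (lookup F v)) ≡ 2 ^ (d ∸ 1)
Σ⊆-contain {suc n} zero =
  trans (Σ⊆-suc n _) (trans (cong₂ _+_ (Σ⊆-count n) (sumOver-0 (allSubsets n))) (+-identityʳ _))
Σ⊆-contain {suc (suc m)} (suc w) =
  trans (Σ⊆-suc (suc m) _) (cong₂ _+_ (Σ⊆-contain w) (trans (Σ⊆-contain w) (sym (+-identityʳ _))))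

Σ⊆-avoid : ∀ {d} (v : Fin d) → Σ⊆ d (λ F → ι (not (lookup F v))) ≡ 2 ^ (d ∸ 1)
Σ⊆-avoid {suc n} zero =
  trans (Σ⊆-suc n _) (cong₂ _+_ (sumOver-0 (allSubsets n)) (Σ⊆-count n))
Σ⊆-avoid {suc (suc m)} (suc w) =
  trans (Σ⊆-suc (suc m) _) (cong₂ _+_ (Σ⊆-avoid w) (trans (Σ⊆-avoid w) (sym (+-identityʳ _))))

2^d≡P+P : ∀ {d} → 1 ≤ d → 2 ^ d ≡ 2 ^ (d ∸ 1) + 2 ^ (d ∸ 1)
2^d≡P+P {suc n} _ = cong (2 ^ n +_) (+-identityʳ (2 ^ n))

ΣV : (d : ℕ) → (Fin d → ℕ) → ℕ
ΣV d = sumOver (allFin d)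

ΣV-suc : ∀ n (g : Fin (suc n) → ℕ) → ΣV (suc n) g ≡ g zero + ΣV n (g ∘ suc)
ΣV-suc n g =
  cong (λ xs → g zero + sum xs) (trans (map-tabulate suc g) (sym (map-tabulate id (g ∘ suc))))

ΣV-partition : ∀ d (p : Fin d → Bool) → ΣV d (ι ∘ p) + ΣV d (λ u → ι (not (p u))) ≡ d
ΣV-partition d p = begin
  ΣV d (ι ∘ p) + ΣV d (λ u → ι (not (p u)))  ≡⟨ sumOver-+ (allFin d) _ _ ⟨
  ΣV d (λ u → ι (p u) + ι (not (p u)))       ≡⟨ sumOver-cong (allFin d) (ι-not ∘ p) ⟩
  ΣV d (λ _ → 1)                             ≡⟨ sumOver-1 (allFin d) ⟩
  length (allFin d)                          ≡⟨ length-tabulate id ⟩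
  d                                          ∎
  where open ≡-Reasoning

full : ∀ d → Subset d
full zero    = []
full (suc n) = inside ∷ full n

allBut : ∀ {d} → Fin d → Subset d
allBut {suc n} zero = outside ∷ full n
allBut (suc u)      = inside ∷ allBut u

lookup-full : ∀ d (x : Fin d) → lookup (full d) x ≡ true
lookup-full (suc n) zero    = refl
lookup-full (suc n) (suc x) = lookup-full n x

⊆-by-lookup : ∀ {d} {F G : Subset d} → (∀ x → lookup F x ≡ true → lookup G x ≡ true) → F ⊆ G
⊆-by-lookup {G = G} F⇒G {x} x∈F = lookup⇒[]= x G (F⇒G x ([]=⇒lookup x∈F))

⊆-full : ∀ {d} (F : Subset d) → F ⊆ full d
⊆-full {d} F = ⊆-by-lookup (λ x _ → lookup-full d x)

avoid⇒⊆allBut : ∀ {d} (v : Fin d) (F : Subset d) → lookup F v ≡ false → F ⊆ allBut v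
avoid⇒⊆allBut v F v∉F = ⊆-by-lookup (members v F v∉F)
  where
  members : ∀ {d} (v : Fin d) (F : Subset d) → lookup F v ≡ false →
            ∀ x → lookup F x ≡ true → lookup (allBut v) x ≡ true
  members zero          (.false ∷ F) refl zero    ()
  members {suc n} zero  F            v∉F  (suc x) x∈F = lookup-full n x
  members (suc v)       F            v∉F  zero    x∈F = refl
  members (suc v)       (b ∷ F)      v∉F  (suc x) x∈F = members v F v∉F x x∈F

allBut-avoiders : ∀ d (v : Fin d) → ΣV d (λ u → ι (not (lookup (allBut u) v))) ≡ 1
allBut-avoiders (suc n) zero =
  trans (ΣV-suc n (λ u → ι (not (lookup (allBut u) zero)))) (cong suc (sumOver-0 (allFin n)))
allBut-avoiders (suc n) (suc w) =
  trans (ΣV-suc n (λ u → ι (not (lookup (allBut u) (suc w)))))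
        (cong₂ _+_ (cong (ι ∘ not) (lookup-full n w)) (allBut-avoiders n w))

isFull : ∀ {d} → Subset d → Bool
isFull []          = true
isFull (true ∷ F)  = isFull F
isFull (false ∷ F) = false

missesAtMostOne : ∀ {d} → Subset d → Bool
missesAtMostOne []          = true
missesAtMostOne (true ∷ F)  = missesAtMostOne F
missesAtMostOne (false ∷ F) = isFull F

Σ⊆-isFull : ∀ d (f : Subset d → ℕ) → Σ⊆ d (λ F → if isFull F then f F else 0) ≡ f (full d)
Σ⊆-isFull zero    f = +-identityʳ _
Σ⊆-isFull (suc n) f = trans (Σ⊆-suc n _)
  (trans (cong₂ _+_ (Σ⊆-isFull n (λ F → f (inside ∷ F))) (sumOver-0 (allSubsets n))) (+-identityʳ _))

Σ⊆-missesAtMostOne : ∀ d (f : Subset d → ℕ) →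
  Σ⊆ d (λ F → if missesAtMostOne F then f F else 0) ≡ f (full d) + ΣV d (f ∘ allBut)
Σ⊆-missesAtMostOne zero    f = refl
Σ⊆-missesAtMostOne (suc n) f = begin
  Σ⊆ (suc n) (λ F → if missesAtMostOne F then f F else 0)
    ≡⟨ Σ⊆-suc n _ ⟩
  Σ⊆ n (λ F → if missesAtMostOne F then f (inside ∷ F) else 0)
    + Σ⊆ n (λ F → if isFull F then f (outside ∷ F) else 0)
    ≡⟨ cong₂ _+_ (Σ⊆-missesAtMostOne n (λ F → f (inside ∷ F))) (Σ⊆-isFull n (λ F → f (outside ∷ F))) ⟩
  f (full (suc n)) + ΣV n (f ∘ allBut ∘ suc) + f (allBut zero)
    ≡⟨ rearrange (f (full (suc n))) _ _ ⟩
  f (full (suc n)) + (f (allBut zero) + ΣV n (f ∘ allBut ∘ suc))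
    ≡⟨ cong (f (full (suc n)) +_) (ΣV-suc n (f ∘ allBut)) ⟨
  f (full (suc n)) + ΣV (suc n) (f ∘ allBut) ∎
  where
  open ≡-Reasoning
  rearrange : ∀ a s b → a + s + b ≡ a + (b + s)
  rearrange = solve-∀

module _ {d : ℕ} (H : Family d) where

  missing : Fin d → ℕ
  missing v = Σ⊆ d (λ F → ι (not (H F) ∧ lookup F v))

  -- Every set containing v is either a member or a non-member.
  deg+missing : ∀ v → deg H v + missing v ≡ 2 ^ (d ∸ 1)
  deg+missing v = begin
    deg H v + missing v                          ≡⟨ sumOver-+ (allSubsets d) _ _ ⟨
    Σ⊆ d (λ F → ι (H F ∧ lookup F v) + ι (not (H F) ∧ lookup F v))
                                                 ≡⟨ sumOver-cong (allSubsets d) (λ F → ι-split′ (H F) (lookup F v)) ⟩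
    Σ⊆ d (λ F → ι (lookup F v))                  ≡⟨ Σ⊆-contain v ⟩
    2 ^ (d ∸ 1)                                  ∎
    where open ≡-Reasoning

  -- If V is missing from H, then every vertex v lies in the non-member V and
  -- in each missing co-singleton V∖u with u ≠ v; so the missing
  -- co-singletons number at most missing(v).
  missingAllBut≤missing : H (full d) ≡ false → ∀ v →
    ΣV d (λ u → ι (not (H (allBut u)))) ≤ missing v
  missingAllBut≤missing V∉H v = begin
    ΣV d (λ u → ι (not (H (allBut u))))
      ≤⟨ sumOver-mono (allFin d) (λ u → split (H (allBut u)) (lookup (allBut u) v)) ⟩
    ΣV d (λ u → ι (not (lookup (allBut u) v)) + ι (not (H (allBut u)) ∧ lookup (allBut u) v))
      ≡⟨ sumOver-+ (allFin d) _ _ ⟩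
    ΣV d (λ u → ι (not (lookup (allBut u) v))) + missingAllButThrough
      ≡⟨ cong (_+ missingAllButThrough) (allBut-avoiders d v) ⟩
    1 + missingAllButThrough
      ≡⟨ cong₂ (λ a b → ι (not a ∧ b) + missingAllButThrough) V∉H (lookup-full d v) ⟨
    ι (not (H (full d)) ∧ lookup (full d) v) + missingAllButThrough
      ≡⟨ Σ⊆-missesAtMostOne d (λ F → ι (not (H F) ∧ lookup F v)) ⟨
    Σ⊆ d (λ F → if missesAtMostOne F then ι (not (H F) ∧ lookup F v) else 0)
      ≤⟨ sumOver-mono (allSubsets d) (λ F → restrict≤ (missesAtMostOne F) _) ⟩
    missing v ∎
    where
    open ≤-Reasoning
    split : ∀ a b → ι (not a) ≤ ι (not b) + ι (not a ∧ b)
    split true  b     = z≤n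
    split false true  = s≤s z≤n
    split false false = s≤s z≤n
    restrict≤ : ∀ b x → (if b then x else 0) ≤ x
    restrict≤ true  x = ≤-refl
    restrict≤ false x = z≤n
    missingAllButThrough : ℕ
    missingAllButThrough = ΣV d (λ u → ι (not (H (allBut u)) ∧ lookup (allBut u) v))

  module _ (hereditary : Hereditary H) where

    -- If V ∈ H then H = 2^V.
    full∈H⇒card : H (full d) ≡ true → card H ≡ 2 ^ d
    full∈H⇒card V∈H =
      trans (sumOver-cong (allSubsets d) (λ F → cong ι (hereditary (full d) F (⊆-full F) V∈H)))
            (Σ⊆-count d)

    -- If V∖v ∈ H then H contains every set avoiding v.
    allBut∈H⇒card : ∀ v → H (allBut v) ≡ true → card H ≡ deg H v + 2 ^ (d ∸ 1)
    allBut∈H⇒card v V∖v∈H = begin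
      card H                                         ≡⟨ sumOver-cong (allSubsets d) (λ F → ι-split (H F) (lookup F v)) ⟨
      Σ⊆ d (λ F → ι (H F ∧ lookup F v) + ι (H F ∧ not (lookup F v)))
                                                     ≡⟨ sumOver-+ (allSubsets d) _ _ ⟩
      deg H v + Σ⊆ d (λ F → ι (H F ∧ not (lookup F v)))
                                                     ≡⟨ cong (deg H v +_) (sumOver-cong (allSubsets d) avoiders∈H) ⟩
      deg H v + Σ⊆ d (λ F → ι (not (lookup F v)))    ≡⟨ cong (deg H v +_) (Σ⊆-avoid v) ⟩
      deg H v + 2 ^ (d ∸ 1)                          ∎
      where
      open ≡-Reasoning
      avoiders∈H : ∀ F → ι (H F ∧ not (lookup F v)) ≡ ι (not (lookup F v))
      avoiders∈H F with lookup F v in v∈F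
      ... | true  = cong ι (∧-zeroʳ (H F))
      ... | false = cong (λ b → ι (b ∧ true))
                         (hereditary (allBut v) F (avoid⇒⊆allBut v F v∈F) V∖v∈H)

module _ {d : ℕ} (c : ℕ) (H : Family d) where

  Low : Fin d → Set
  Low v = deg H v + (c + 1) ≤ 2 ^ (d ∸ 1)

  low? : Decidable Low
  low? v = deg H v + (c + 1) ≤? 2 ^ (d ∸ 1)

  numHigh : ℕ
  numHigh = ΣV d (λ v → ι (does (¬? (low? v))))

  numLow+numHigh : numLowDeg H (c + 1) (2 ^ (d ∸ 1)) + numHigh ≡ d
  numLow+numHigh =
    trans (cong (_+ numHigh) (length-filter≡count low? (allFin d))) (ΣV-partition d (does ∘ low?))

  high⇒missing≤c : ∀ v → ¬ Low v → missing H v ≤ c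
  high⇒missing≤c v high = ≤-pred (+-cancelˡ-≤ (deg H v) _ _ (begin
    deg H v + suc (missing H v)  ≡⟨ +-suc (deg H v) (missing H v) ⟩
    suc (deg H v + missing H v)  ≡⟨ cong suc (deg+missing H v) ⟩
    suc (2 ^ (d ∸ 1))            ≤⟨ ≰⇒> high ⟩
    deg H v + (c + 1)            ≡⟨ cong (deg H v +_) (+-comm c 1) ⟩
    deg H v + suc c              ∎))
    where open ≤-Reasoning

  module _ (hereditary : Hereditary H) (d≥1 : 1 ≤ d) (small : card H + c + 1 ≤ 2 ^ d) where

    full∉H : H (full d) ≡ false
    full∉H with H (full d) in V∈H
    ... | false = refl
    ... | true  = ⊥-elim (<-irrefl (full∈H⇒card H hereditary V∈H) card<2^d)
      where
      card<2^d : card H < 2 ^ d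
      card<2^d = ≤-trans (s≤s (m≤m+n (card H) c)) (subst (_≤ 2 ^ d) (+-comm (card H + c) 1) small)

    -- If V∖v ∈ H then |H| = deg(v) + 2^(d-1), which forces v to be low.
    allBut∈H⇒low : ∀ v → H (allBut v) ≡ true → Low v
    allBut∈H⇒low v V∖v∈H = +-cancelʳ-≤ (2 ^ (d ∸ 1)) _ _ (begin
      deg H v + (c + 1) + 2 ^ (d ∸ 1)  ≡⟨ rearrange (deg H v) c (2 ^ (d ∸ 1)) ⟩
      deg H v + 2 ^ (d ∸ 1) + c + 1    ≡⟨ cong (λ k → k + c + 1) (allBut∈H⇒card H hereditary v V∖v∈H) ⟨
      card H + c + 1                   ≤⟨ small ⟩
      2 ^ d                            ≡⟨ 2^d≡P+P d≥1 ⟩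
      2 ^ (d ∸ 1) + 2 ^ (d ∸ 1)        ∎)
      where
      open ≤-Reasoning
      rearrange : ∀ a c p → a + (c + 1) + p ≡ a + p + c + 1
      rearrange = solve-∀

    -- So every high vertex u has V∖u ∉ H.
    high⇒allBut∉H : ∀ u → ι (does (¬? (low? u))) ≤ ι (not (H (allBut u)))
    high⇒allBut∉H u with H (allBut u) in V∖u∈H
    ... | false = ι≤1 _
    ... | true rewrite dec-true (low? u) (allBut∈H⇒low u V∖u∈H) = z≤n

    numHigh≤c : numHigh ≤ c
    numHigh≤c with 1 ≤? numHigh
    ... | no  noHigh = ≤-trans (≤-reflexive (n<1⇒n≡0 (≰⇒> noHigh))) z≤n
    ... | yes someHigh with count-witness (¬? ∘ low?) (allFin d) someHigh
    ...   | v , high = begin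
      numHigh                              ≤⟨ sumOver-mono (allFin d) high⇒allBut∉H ⟩
      ΣV d (λ u → ι (not (H (allBut u))))  ≤⟨ missingAllBut≤missing H full∉H v ⟩
      missing H v                          ≤⟨ high⇒missing≤c v high ⟩
      c                                    ∎
      where open ≤-Reasoning

    manyLow : d ∸ c ≤ numLowDeg H (c + 1) (2 ^ (d ∸ 1))
    manyLow = m≤n+o⇒m∸n≤o d c (begin
      d            ≡⟨ numLow+numHigh ⟨
      L + numHigh  ≤⟨ +-monoʳ-≤ L numHigh≤c ⟩
      L + c        ≡⟨ +-comm L c ⟩
      c + L        ∎)
      where
      open ≤-Reasoning
      L = numLowDeg H (c + 1) (2 ^ (d ∸ 1))

  degree-bound⇒high : ∀ v → 2 ^ (d ∸ 1) ≤ deg H v + c → ¬ Low v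
  degree-bound⇒high v P≤deg+c low =
    1+n≰n (subst (_≤ c) (+-comm c 1) (+-cancelˡ-≤ (deg H v) _ _ (≤-trans low P≤deg+c)))

  -- Part (2): if every vertex is high and d > c, then |H| ≥ 2^d - c, since
  -- otherwise part (1) would supply d - c ≥ 1 low vertices.
  allHigh⇒large : Hereditary H → 1 ≤ d → c + 1 ≤ d → (∀ v → ¬ Low v) → 2 ^ d ≤ card H + c
  allHigh⇒large hereditary d≥1 c<d allHigh with 2 ^ d ≤? card H + c
  ... | yes large   = large
  ... | no  ¬large = ⊥-elim (1+n≰n (begin
    1                                   ≤⟨ m<n⇒0<n∸m (subst (_≤ d) (+-comm c 1) c<d) ⟩
    d ∸ c                               ≤⟨ manyLow hereditary d≥1 small ⟩
    length (filter low? (allFin d))     ≡⟨ cong length (filter-none low? (All.universal allHigh (allFin d))) ⟩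
    0                                   ∎))
    where
    open ≤-Reasoning
    small : card H + c + 1 ≤ 2 ^ d
    small = subst (_≤ 2 ^ d) (+-comm 1 (card H + c)) (≰⇒> ¬large)

lemma3p2 : (d c : ℕ) → 1 ≤ d → 1 ≤ c → (H : Family d) → Hereditary H →
    ((card H + c + 1 ≤ 2 ^ d → d ∸ c ≤ numLowDeg H (c + 1) (2 ^ (d ∸ 1)))
    × (c + 1 ≤ d → ((v : Fin d) → 2 ^ (d ∸ 1) ≤ deg H v + c) → 2 ^ d ≤ card H + c))
lemma3p2 d c d≥1 _ H hereditary =
  manyLow c H hereditary d≥1 ,
  λ c<d degree-bound →
    allHigh⇒large c H hereditary d≥1 c<d (λ v → degree-bound⇒high c H v (degree-bound v))
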